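{- Let $Q$ be an $s\times t$ $(0,1)$-matrix that is not all-zero, let its core $Q_{core}$ be an $s'\times t'$ matrix, and let $m\ge 2s$, $n\ge 2t$. Then \[\mathrm{m}(m,n,Q)=mn-(m-2s)(t-t')-(n-2t)(s-s')-|NW(Q)|-|SW(Q)|-|NE(Q)|-|SE(Q)|.\]
   Context: All matrices are $(0,1)$-matrices. An $m\times n$ matrix $A$ is $Q$-forcing if every $s\times t$ submatrix of $A$ (any $s$ rows and any $t$ columns, order kept) is entrywise $\ge Q$; $\mathrm{m}(m,n,Q)$ is the minimum number of $1$-entries of an $m\times n$ $Q$-forcing matrix. $Q_{core}$ is the matrix obtained from $Q$ by deleting all-zero rows from the top and bottom and all-zero columns from the left and right until each of its first row, last row, first column and last column contains a $1$-entry. Corner functions: $NW(Q)$ is the set of positions $(i,j)$ with $Q_{i,j}=0$ such that no $1$-entry of $Q$ is at a position $(i',j')$ with $i'\le i$, $j'\le j$; $SW(Q)$: same with $i'\ge i$, $j'\le j$; $NE(Q)$: same with $i'\le i$, $j'\ge j$; $SE(Q)$: same with $i'\ge i$, $j'\ge j$. $|X|$ denotes the cardinality of a set $X$ of positions. -}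

module Defs where

open import Data.Bool using (Bool; true; false; not; _∧_; _∨_)
open import Data.Nat using (ℕ; zero; suc; _+_; _∸_; _≤ᵇ_; _≤_; _<_)
open import Data.Fin using (Fin; toℕ) renaming (zero to fzero; suc to fsuc)
open import Data.Product using (Σ; ∃; ∃-syntax; _×_; _,_)
open import Relation.Binary.PropositionalEquality using (_≡_)

Matrix : ℕ → ℕ → Set
Matrix m n = Fin m → Fin n → Bool

anyFin : ∀ {n} → (Fin n → Bool) → Bool
anyFin {zero}  f = false
anyFin {suc n} f = f fzero ∨ anyFin (λ i → f (fsuc i))

sumFin : ∀ {n} → (Fin n → ℕ) → ℕ
sumFin {zero}  f = 0
sumFin {suc n} f = f fzero + sumFin (λ i → f (fsuc i))

bit : Bool → ℕ
bit true  = 1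
bit false = 0

count2 : ∀ {m n} → (Fin m → Fin n → Bool) → ℕ
count2 f = sumFin (λ i → sumFin (λ j → bit (f i j)))

ones : ∀ {m n} → Matrix m n → ℕ
ones = count2

Increasing : ∀ {k m} → (Fin k → Fin m) → Set
Increasing {k} r = ∀ (i j : Fin k) → toℕ i < toℕ j → toℕ (r i) < toℕ (r j)

SubGeq : ∀ {s t m n} → Matrix s t → Matrix m n → (Fin s → Fin m) → (Fin t → Fin n) → Set
SubGeq Q A r c = ∀ i j → Q i j ≡ true → A (r i) (c j) ≡ true

Forcing : ∀ {s t m n} → Matrix s t → Matrix m n → Set
Forcing Q A = ∀ r c → Increasing r → Increasing c → SubGeq Q A r c

-- k = m(m,n,Q): k is the minimum number of 1-entries of an m × n Q-forcing matrix.
IsMinForcing : ∀ {s t} → (m n : ℕ) → Matrix s t → ℕ → Set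
IsMinForcing m n Q k =
  (Σ (Matrix m n) λ A → Forcing Q A × ones A ≡ k)
  × (∀ (A : Matrix m n) → Forcing Q A → k ≤ ones A)

NotAllZero : ∀ {s t} → Matrix s t → Set
NotAllZero Q = ∃[ i ] ∃[ j ] Q i j ≡ true

ZeroRow : ∀ {s t} → Matrix s t → Fin s → Set
ZeroRow Q i = ∀ j → Q i j ≡ false

ZeroCol : ∀ {s t} → Matrix s t → Fin t → Set
ZeroCol Q j = ∀ i → Q i j ≡ false

CoreRows : ∀ {s t} → Matrix s t → ℕ → Set
CoreRows {s} Q s' = ∃[ a ] ∃[ b ]
  ( a + s' + b ≡ s
  × 1 ≤ s'
  × (∀ i → toℕ i < a → ZeroRow Q i)
  × (∀ i → a + s' ≤ toℕ i → ZeroRow Q i)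
  × (∃[ i ] toℕ i ≡ a × ¬Zero i)
  × (∃[ i ] suc (toℕ i) ≡ a + s' × ¬Zero i))
  where
  ¬Zero : Fin s → Set
  ¬Zero i = ∃[ j ] Q i j ≡ true

CoreCols : ∀ {s t} → Matrix s t → ℕ → Set
CoreCols {s} {t} Q t' = ∃[ a ] ∃[ b ]
  ( a + t' + b ≡ t
  × 1 ≤ t'
  × (∀ j → toℕ j < a → ZeroCol Q j)
  × (∀ j → a + t' ≤ toℕ j → ZeroCol Q j)
  × (∃[ j ] toℕ j ≡ a × ¬Zero j)
  × (∃[ j ] suc (toℕ j) ≡ a + t' × ¬Zero j))
  where
  ¬Zero : Fin t → Set
  ¬Zero j = ∃[ i ] Q i j ≡ true

CoreDims : ∀ {s t} → Matrix s t → ℕ → ℕ → Set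
CoreDims Q s' t' = CoreRows Q s' × CoreCols Q t'

-- Corner sets, as Boolean indicator functions on positions.
-- NW: Q i j = 0 and no 1-entry at (i',j') with i' ≤ i, j' ≤ j; etc.
corner : ∀ {s t} → (ℕ → ℕ → Bool) → (ℕ → ℕ → Bool) → Matrix s t → Fin s → Fin t → Bool
corner rowOK colOK Q i j =
  not (Q i j) ∧
  not (anyFin (λ i' → anyFin (λ j' →
        rowOK (toℕ i') (toℕ i) ∧ colOK (toℕ j') (toℕ j) ∧ Q i' j')))

_≥ᵇ_ : ℕ → ℕ → Bool
x ≥ᵇ y = y ≤ᵇ x

NW SW NE SE : ∀ {s t} → Matrix s t → Fin s → Fin t → Bool
NW = corner _≤ᵇ_ _≤ᵇ_
SW = corner _≥ᵇ_ _≤ᵇ_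
NE = corner _≤ᵇ_ _≥ᵇ_
SE = corner _≥ᵇ_ _≥ᵇ_

-- A position x of an m-row matrix can carry row i of Q in some choice of s increasing rows exactly
-- when i ≤ x and x + s ≤ i + m; likewise for columns. So the Q-forcing matrices are exactly those
-- containing the matrix 'forced' whose 1-entries are the positions able to carry some 1-entry of Q,
-- and m(m,n,Q) is the number of 1-entries of 'forced'. For m = s + p + s and n = t + q + t this
-- matrix splits into 3 × 3 blocks. In the top rows x < s the admissible rows of Q are those ≤ x,
-- in the p middle rows all of them, in the bottom rows those ≥ x (columns likewise). A corner block
-- thus has a 1 wherever Q has a 1 weakly towards that corner, i.e. st − |corner set| ones; an edge
-- band counts the rows (columns) of Q reached from above plus those reached from below, which is
-- s + s' (t + t') by the definition of the core; the centre block is full as Q ≠ 0.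
module Submission where

open import Defs
open import Data.Bool using (Bool; true; false; not; _∧_; _∨_)
open import Data.Bool.Properties
  using (∧-conicalˡ; ∧-conicalʳ; ∧-identityʳ; ⇔→≡; ¬-not; not-¬; T-≡)
open import Data.Fin using (Fin; toℕ; fromℕ; fromℕ<; _↑ˡ_; _↑ʳ_) renaming (zero to fzero; suc to fsuc)
open import Data.Fin.Properties
  using (toℕ-injective; toℕ-fromℕ; toℕ-fromℕ<; toℕ<n; toℕ≤pred[n]; toℕ-↑ˡ; toℕ-↑ʳ)
open import Data.Nat using (ℕ; zero; suc; _+_; _*_; _≤ᵇ_; _≤_; _<_; z≤n; s≤s; s≤s⁻¹; z<s)
open import Data.Nat.Properties
open import Algebra.Properties.Semiring.Sum +-*-semiring
  using (sum; sum-syntax; sum-cong-≗; ∑-distrib-+; *-distribˡ-sum)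
open import Data.Nat.Tactic.RingSolver using (solve-∀)
open import Data.Product using (Σ; ∃-syntax; _×_; _,_; proj₁; proj₂)
open import Function using (_∘_; mk⇔; Equivalence)
open import Relation.Binary.PropositionalEquality

sumFin≡sum : ∀ {n} (f : Fin n → ℕ) → sumFin f ≡ sum f
sumFin≡sum {zero}  f = refl
sumFin≡sum {suc n} f = cong (f fzero +_) (sumFin≡sum (f ∘ fsuc))

sum-const : ∀ n c → ∑[ i < n ] c ≡ n * c
sum-const zero    c = refl
sum-const (suc n) c = cong (c +_) (sum-const n c)

sum-mono-≤ : ∀ {n} {f g : Fin n → ℕ} → (∀ i → f i ≤ g i) → sum f ≤ sum g
sum-mono-≤ {zero}  f≤g = z≤n
sum-mono-≤ {suc n} f≤g = +-mono-≤ (f≤g fzero) (sum-mono-≤ (f≤g ∘ fsuc))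

sum-↑ : ∀ a b (f : Fin (a + b) → ℕ) → sum f ≡ ∑[ i < a ] f (i ↑ˡ b) + ∑[ j < b ] f (a ↑ʳ j)
sum-↑ zero    b f = refl
sum-↑ (suc a) b f = trans (cong (f fzero +_) (sum-↑ a b (f ∘ fsuc))) (sym (+-assoc (f fzero) _ _))

sum-piecewise : ∀ {n} a b → a + b ≡ n → (f : Fin n → ℕ) {u v : ℕ} →
  (∀ i → toℕ i < a → f i ≡ u) → (∀ i → a ≤ toℕ i → f i ≡ v) → sum f ≡ a * u + b * v
sum-piecewise a b refl f {u} {v} low high = begin
  sum f                                          ≡⟨ sum-↑ a b f ⟩
  ∑[ i < a ] f (i ↑ˡ b) + ∑[ j < b ] f (a ↑ʳ j)  ≡⟨ cong₂ _+_ (sum-cong-≗ left) (sum-cong-≗ right) ⟩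
  ∑[ i < a ] u + ∑[ j < b ] v                    ≡⟨ cong₂ _+_ (sum-const a u) (sum-const b v) ⟩
  a * u + b * v                                  ∎
  where
  open ≡-Reasoning
  left : ∀ i → f (i ↑ˡ b) ≡ u
  left i = low _ (subst (_< a) (sym (toℕ-↑ˡ i b)) (toℕ<n i))
  right : ∀ j → f (a ↑ʳ j) ≡ v
  right j = high _ (subst (a ≤_) (sym (toℕ-↑ʳ a j)) (m≤m+n a (toℕ j)))

sum-+-* : ∀ {n} c (f g h : Fin n → ℕ) →
  ∑[ i < n ] (f i + c * g i + h i) ≡ sum f + c * sum g + sum h
sum-+-* c f g h = begin
  ∑[ i < _ ] (f i + c * g i + h i)          ≡⟨ ∑-distrib-+ (λ i → f i + c * g i) h ⟩
  ∑[ i < _ ] (f i + c * g i) + sum h        ≡⟨ cong (_+ sum h) (∑-distrib-+ f (λ i → c * g i)) ⟩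
  sum f + ∑[ i < _ ] (c * g i) + sum h      ≡⟨ cong (λ z → sum f + z + sum h) (*-distribˡ-sum c g) ⟨
  sum f + c * sum g + sum h                 ∎
  where open ≡-Reasoning

count2≡∑∑ : ∀ {m n} (f : Fin m → Fin n → Bool) → count2 f ≡ ∑[ i < m ] ∑[ j < n ] bit (f i j)
count2≡∑∑ {m} {n} f = trans (sumFin≡sum (λ i → sumFin (λ j → bit (f i j))))
  (sum-cong-≗ (λ i → sumFin≡sum (λ j → bit (f i j))))

≤⇒≤ᵇ≡true : ∀ {m n} → m ≤ n → (m ≤ᵇ n) ≡ true
≤⇒≤ᵇ≡true m≤n = Equivalence.to T-≡ (≤⇒≤ᵇ m≤n)

≤ᵇ≡true⇒≤ : ∀ {m n} → (m ≤ᵇ n) ≡ true → m ≤ n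
≤ᵇ≡true⇒≤ {m} {n} e = ≤ᵇ⇒≤ m n (Equivalence.from T-≡ e)

≤ᵇ-cong : ∀ {a b c d} → (a ≤ b → c ≤ d) → (c ≤ d → a ≤ b) → (a ≤ᵇ b) ≡ (c ≤ᵇ d)
≤ᵇ-cong to from =
  ⇔→≡ (mk⇔ (≤⇒≤ᵇ≡true ∘ to ∘ ≤ᵇ≡true⇒≤) (≤⇒≤ᵇ≡true ∘ from ∘ ≤ᵇ≡true⇒≤))

∧-≡true : ∀ {x y} → x ≡ true → y ≡ true → (x ∧ y) ≡ true
∧-≡true refl refl = refl

bit-mono : ∀ {a b} → (a ≡ true → b ≡ true) → bit a ≤ bit b
bit-mono {false} a⇒b = z≤n
bit-mono {true}  a⇒b rewrite a⇒b refl = ≤-refl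

bit-complement : ∀ a q → (q ≡ true → a ≡ true) → bit a + bit (not q ∧ not a) ≡ 1
bit-complement true  true  _   = refl
bit-complement true  false _   = refl
bit-complement false false _   = refl
bit-complement false true  q⇒a with q⇒a refl
... | ()

count2-mono : ∀ {m n} {A B : Fin m → Fin n → Bool} →
  (∀ x y → A x y ≡ true → B x y ≡ true) → count2 A ≤ count2 B
count2-mono {A = A} {B} A⊆B = subst₂ _≤_ (sym (count2≡∑∑ A)) (sym (count2≡∑∑ B))
  (sum-mono-≤ (λ x → sum-mono-≤ (λ y → bit-mono (A⊆B x y))))

count2-complement : ∀ {m n} (f g : Fin m → Fin n → Bool) →
  (∀ i j → bit (f i j) + bit (g i j) ≡ 1) → count2 f + count2 g ≡ m * n
count2-complement {m} {n} f g f+g≡1 = begin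
  count2 f + count2 g
    ≡⟨ cong₂ _+_ (count2≡∑∑ f) (count2≡∑∑ g) ⟩
  ∑[ i < m ] ∑[ j < n ] bit (f i j) + ∑[ i < m ] ∑[ j < n ] bit (g i j)
    ≡⟨ ∑-distrib-+ (λ i → ∑[ j < n ] bit (f i j)) _ ⟨
  ∑[ i < m ] (∑[ j < n ] bit (f i j) + ∑[ j < n ] bit (g i j))
    ≡⟨ sum-cong-≗ (λ i → ∑-distrib-+ (λ j → bit (f i j)) _) ⟨
  ∑[ i < m ] ∑[ j < n ] (bit (f i j) + bit (g i j))
    ≡⟨ sum-cong-≗ (λ i → trans (sum-cong-≗ (f+g≡1 i)) (sum-const n 1)) ⟩
  ∑[ i < m ] (n * 1)
    ≡⟨ sum-const m (n * 1) ⟩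
  m * (n * 1)
    ≡⟨ cong (m *_) (*-identityʳ n) ⟩
  m * n ∎
  where open ≡-Reasoning

anyFin-intro : ∀ {n} (f : Fin n → Bool) i → f i ≡ true → anyFin f ≡ true
anyFin-intro f fzero    fi = cong (_∨ anyFin (f ∘ fsuc)) fi
anyFin-intro f (fsuc i) fi with f fzero
... | true  = refl
... | false = anyFin-intro (f ∘ fsuc) i fi

anyFin-elim : ∀ {n} (f : Fin n → Bool) → anyFin f ≡ true → ∃[ i ] f i ≡ true
anyFin-elim {suc n} f e with f fzero in f0
... | true  = fzero , f0
... | false = let i , fi = anyFin-elim (f ∘ fsuc) e in fsuc i , fi

hits : ∀ {s t} → Matrix s t → (Fin s → Bool) → (Fin t → Bool) → Bool
hits Q R C = anyFin λ i → anyFin λ j → R i ∧ C j ∧ Q i j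

module _ {s t} {Q : Matrix s t} {R : Fin s → Bool} {C : Fin t → Bool} where

  hits-intro : ∀ i j → R i ≡ true → C j ≡ true → Q i j ≡ true → hits Q R C ≡ true
  hits-intro i j Ri Cj Qij =
    anyFin-intro _ i (anyFin-intro _ j (∧-≡true Ri (∧-≡true Cj Qij)))

  hits-elim : hits Q R C ≡ true → ∃[ i ] ∃[ j ] R i ≡ true × C j ≡ true × Q i j ≡ true
  hits-elim e =
    let i , ei = anyFin-elim _ e
        j , eij = anyFin-elim _ ei
        rest = ∧-conicalʳ (R i) _ eij
    in i , j , ∧-conicalˡ (R i) _ eij , ∧-conicalˡ (C j) _ rest , ∧-conicalʳ (C j) _ rest

  hits-false : (∀ i j → R i ≡ true → C j ≡ true → Q i j ≡ false) → hits Q R C ≡ false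
  hits-false none = ¬-not λ h → let i , j , Ri , Cj , Qij = hits-elim h in not-¬ (none i j Ri Cj) Qij

hits-mono : ∀ {s t} {Q : Matrix s t} {R R′ : Fin s → Bool} {C C′ : Fin t → Bool} →
  (∀ i → R i ≡ true → R′ i ≡ true) → (∀ j → C j ≡ true → C′ j ≡ true) →
  hits Q R C ≡ true → hits Q R′ C′ ≡ true
hits-mono {Q = Q} {R} {R′} {C} {C′} R⊆R′ C⊆C′ h =
  let i , j , Ri , Cj , Qij = hits-elim {Q = Q} {R} {C} h
  in hits-intro {Q = Q} {R′} {C′} i j (R⊆R′ i Ri) (C⊆C′ j Cj) Qij

hits-cong : ∀ {s t} {Q : Matrix s t} {R R′ : Fin s → Bool} {C C′ : Fin t → Bool} →
  R ≗ R′ → C ≗ C′ → hits Q R C ≡ hits Q R′ C′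
hits-cong {Q = Q} {R} {R′} {C} {C′} R≗R′ C≗C′ = ⇔→≡ (mk⇔
  (hits-mono {Q = Q} (λ i → trans (sym (R≗R′ i))) (λ j → trans (sym (C≗C′ j))))
  (hits-mono {Q = Q} (λ i → trans (R≗R′ i)) (λ j → trans (C≗C′ j))))

transpose : ∀ {s t} → Matrix s t → Matrix t s
transpose Q j i = Q i j

hits-transpose : ∀ {s t} (Q : Matrix s t) R C → hits Q R C ≡ hits (transpose Q) C R
hits-transpose Q R C = ⇔→≡ (mk⇔
  (λ h → let i , j , Ri , Cj , Qij = hits-elim {Q = Q} {R} {C} h
         in hits-intro {Q = transpose Q} {C} {R} j i Cj Ri Qij)
  (λ h → let j , i , Cj , Ri , Qij = hits-elim {Q = transpose Q} {C} {R} h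
         in hits-intro {Q = Q} {R} {C} i j Ri Cj Qij))

-- The i-th of k increasingly chosen positions among M can be position x.
inWindow : (k M i x : ℕ) → Bool
inWindow k M i x = (i ≤ᵇ x) ∧ (x + k ≤ᵇ i + M)

Increasing-tail : ∀ {k M} {r : Fin (suc k) → Fin M} → Increasing r → Increasing (r ∘ fsuc)
Increasing-tail inc a b = inc (fsuc a) (fsuc b) ∘ s≤s

Increasing-spread : ∀ {k M} {r : Fin k → Fin M} → Increasing r →
  ∀ i j → toℕ i ≤ toℕ j → toℕ (r i) + toℕ j ≤ toℕ (r j) + toℕ i
Increasing-spread inc fzero fzero _ = ≤-refl
Increasing-spread {suc zero} inc fzero (fsuc ()) _
Increasing-spread {suc (suc k)} {r = r} inc fzero (fsuc j) _ = begin
  toℕ (r fzero) + suc (toℕ j)    ≡⟨ +-suc (toℕ (r fzero)) (toℕ j) ⟩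
  suc (toℕ (r fzero) + toℕ j)    ≤⟨ +-monoˡ-≤ (toℕ j) (inc fzero (fsuc fzero) z<s) ⟩
  toℕ (r (fsuc fzero)) + toℕ j   ≤⟨ Increasing-spread (Increasing-tail inc) fzero j z≤n ⟩
  toℕ (r (fsuc j)) + 0           ∎
  where open ≤-Reasoning
Increasing-spread {r = r} inc (fsuc i) (fsuc j) (s≤s i≤j) = begin
  toℕ (r (fsuc i)) + suc (toℕ j)   ≡⟨ +-suc (toℕ (r (fsuc i))) (toℕ j) ⟩
  suc (toℕ (r (fsuc i)) + toℕ j)   ≤⟨ s≤s (Increasing-spread (Increasing-tail inc) i j i≤j) ⟩
  suc (toℕ (r (fsuc j)) + toℕ i)   ≡⟨ +-suc (toℕ (r (fsuc j))) (toℕ i) ⟨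
  toℕ (r (fsuc j)) + suc (toℕ i)   ∎
  where open ≤-Reasoning

Increasing⇒inWindow : ∀ {k M} {r : Fin k → Fin M} → Increasing r →
  ∀ i → inWindow k M (toℕ i) (toℕ (r i)) ≡ true
Increasing⇒inWindow {suc k} {M} {r} inc i = ∧-≡true (≤⇒≤ᵇ≡true below) (≤⇒≤ᵇ≡true above)
  where
  open ≤-Reasoning
  last : Fin (suc k)
  last = fromℕ k
  i≤last : toℕ i ≤ toℕ last
  i≤last = subst (toℕ i ≤_) (sym (toℕ-fromℕ k)) (toℕ≤pred[n] i)
  below : toℕ i ≤ toℕ (r i)
  below = begin
    toℕ i                    ≤⟨ m≤n+m (toℕ i) (toℕ (r fzero)) ⟩
    toℕ (r fzero) + toℕ i    ≤⟨ Increasing-spread inc fzero i z≤n ⟩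
    toℕ (r i) + 0            ≡⟨ +-identityʳ (toℕ (r i)) ⟩
    toℕ (r i)                ∎
  above : toℕ (r i) + suc k ≤ toℕ i + M
  above = begin
    toℕ (r i) + suc k            ≡⟨ +-suc (toℕ (r i)) k ⟩
    suc (toℕ (r i) + k)          ≡⟨ cong (λ z → suc (toℕ (r i) + z)) (toℕ-fromℕ k) ⟨
    suc (toℕ (r i) + toℕ last)   ≤⟨ s≤s (Increasing-spread inc i last i≤last) ⟩
    suc (toℕ (r last) + toℕ i)   ≤⟨ +-monoˡ-≤ (toℕ i) (toℕ<n (r last)) ⟩
    M + toℕ i                    ≡⟨ +-comm M (toℕ i) ⟩
    toℕ i + M                    ∎

shift : ∀ {k M} d → d + k ≤ M → Fin k → Fin M
shift d d+k≤M l = fromℕ< (<-≤-trans (+-monoʳ-< d (toℕ<n l)) d+k≤M)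

toℕ-shift : ∀ {k M} d (d+k≤M : d + k ≤ M) (l : Fin k) → toℕ (shift d d+k≤M l) ≡ d + toℕ l
toℕ-shift d d+k≤M l = toℕ-fromℕ< _

shift-increasing : ∀ {k M} d (d+k≤M : d + k ≤ M) → Increasing (shift d d+k≤M)
shift-increasing d d+k≤M a b a<b
  rewrite toℕ-shift d d+k≤M a | toℕ-shift d d+k≤M b = +-monoʳ-< d a<b

inWindow⇒Increasing : ∀ {k M} (i : Fin k) (x : Fin M) → inWindow k M (toℕ i) (toℕ x) ≡ true →
  ∃[ r ] Increasing r × r i ≡ x
inWindow⇒Increasing {k} {M} i x w =
  shift d d+k≤M , shift-increasing d d+k≤M ,
  toℕ-injective (trans (toℕ-shift d d+k≤M i) (trans (+-comm d (toℕ i)) i+d≡x))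
  where
  i≤x : toℕ i ≤ toℕ x
  i≤x = ≤ᵇ≡true⇒≤ (∧-conicalˡ (toℕ i ≤ᵇ toℕ x) _ w)
  x+k≤i+M : toℕ x + k ≤ toℕ i + M
  x+k≤i+M = ≤ᵇ≡true⇒≤ (∧-conicalʳ (toℕ i ≤ᵇ toℕ x) _ w)
  d : ℕ
  d = proj₁ (m≤n⇒∃[o]m+o≡n i≤x)
  i+d≡x : toℕ i + d ≡ toℕ x
  i+d≡x = proj₂ (m≤n⇒∃[o]m+o≡n i≤x)
  d+k≤M : d + k ≤ M
  d+k≤M = +-cancelˡ-≤ (toℕ i) (d + k) M
    (subst (_≤ toℕ i + M) (trans (cong (_+ k) (sym i+d≡x)) (+-assoc (toℕ i) d k)) x+k≤i+M)

window : (k M : ℕ) → Fin M → Fin k → Bool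
window k M x i = inWindow k M (toℕ i) (toℕ x)

forced : ∀ {s t} → Matrix s t → (m n : ℕ) → Matrix m n
forced {s} {t} Q m n x y = hits Q (window s m x) (window t n y)

module _ {s t} (Q : Matrix s t) (m n : ℕ) where

  forced-forcing : Forcing Q (forced Q m n)
  forced-forcing r c inc-r inc-c i j Qij =
    hits-intro {Q = Q} {window s m (r i)} {window t n (c j)} i j
      (Increasing⇒inWindow inc-r i) (Increasing⇒inWindow inc-c j) Qij

  forced-⊆ : ∀ {A : Matrix m n} → Forcing Q A → ∀ x y → forced Q m n x y ≡ true → A x y ≡ true
  forced-⊆ {A} A-forcing x y h =
    let i , j , wi , wj , Qij = hits-elim {Q = Q} {window s m x} {window t n y} h
        r , inc-r , ri≡x = inWindow⇒Increasing i x wi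
        c , inc-c , cj≡y = inWindow⇒Increasing j y wj
    in subst₂ (λ x y → A x y ≡ true) ri≡x cj≡y (A-forcing r c inc-r inc-c i j Qij)

  forced-isMinForcing : IsMinForcing m n Q (ones (forced Q m n))
  forced-isMinForcing =
    (forced Q m n , forced-forcing , refl) , λ A A-forcing → count2-mono (forced-⊆ A-forcing)

module _ {k p : ℕ} where

  inWindow-top : ∀ {i x} → x < k → inWindow k (k + p + k) i x ≡ (i ≤ᵇ x)
  inWindow-top {i} {x} x<k =
    trans (cong ((i ≤ᵇ x) ∧_) (≤⇒≤ᵇ≡true (≤-trans x+k≤k+p+k (m≤n+m _ i)))) (∧-identityʳ (i ≤ᵇ x))
    where
    x+k≤k+p+k : x + k ≤ k + p + k
    x+k≤k+p+k = +-monoˡ-≤ k (≤-trans (<⇒≤ x<k) (m≤m+n k p))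

  inWindow-mid : ∀ {i v} → i ≤ k → v ≤ p → inWindow k (k + p + k) i (k + v) ≡ true
  inWindow-mid {i} {v} i≤k v≤p = ∧-≡true
    (≤⇒≤ᵇ≡true (≤-trans i≤k (m≤m+n k v)))
    (≤⇒≤ᵇ≡true (≤-trans (+-monoˡ-≤ k (+-monoʳ-≤ k v≤p)) (m≤n+m _ i)))

  inWindow-bot : ∀ {i u} → i < k → inWindow k (k + p + k) i (k + p + u) ≡ (u ≤ᵇ i)
  inWindow-bot {i} {u} i<k =
    trans (cong (_∧ (k + p + u + k ≤ᵇ i + M)) (≤⇒≤ᵇ≡true i≤k+p+u))
          (≤ᵇ-cong (+-cancelʳ-≤ M u i ∘ subst (_≤ i + M) shuffle)
                   (subst (_≤ i + M) (sym shuffle) ∘ +-monoˡ-≤ M))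
    where
    M : ℕ
    M = k + p + k
    i≤k+p+u : i ≤ k + p + u
    i≤k+p+u = ≤-trans (<⇒≤ i<k) (≤-trans (m≤m+n k p) (m≤m+n (k + p) u))
    shuffle : k + p + u + k ≡ u + M
    shuffle = lemma k p u
      where
      lemma : ∀ k p u → k + p + u + k ≡ u + (k + p + k)
      lemma = solve-∀

sum-windows : ∀ k p (g : (Fin k → Bool) → ℕ) → (∀ {R R′} → R ≗ R′ → g R ≡ g R′) →
  ∑[ x < k + p + k ] g (window k (k + p + k) x)
    ≡ ∑[ x < k ] g (λ i → toℕ i ≤ᵇ toℕ x) + p * g (λ _ → true) + ∑[ u < k ] g (λ i → toℕ u ≤ᵇ toℕ i)
sum-windows k p g g-cong = begin
  sum G
    ≡⟨ sum-↑ (k + p) k G ⟩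
  ∑[ y < k + p ] G (y ↑ˡ k) + ∑[ u < k ] G (k + p ↑ʳ u)
    ≡⟨ cong (_+ ∑[ u < k ] G (k + p ↑ʳ u)) (sum-↑ k p (λ y → G (y ↑ˡ k))) ⟩
  ∑[ x < k ] G (x ↑ˡ p ↑ˡ k) + ∑[ v < p ] G ((k ↑ʳ v) ↑ˡ k) + ∑[ u < k ] G (k + p ↑ʳ u)
    ≡⟨ cong₂ _+_ (cong₂ _+_ (sum-cong-≗ top) (trans (sum-cong-≗ mid) (sum-const p _))) (sum-cong-≗ bot) ⟩
  ∑[ x < k ] g (λ i → toℕ i ≤ᵇ toℕ x) + p * g (λ _ → true) + ∑[ u < k ] g (λ i → toℕ u ≤ᵇ toℕ i)
    ∎
  where
  open ≡-Reasoning
  M : ℕ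
  M = k + p + k
  G : Fin M → ℕ
  G x = g (window k M x)
  at : ∀ {x : Fin M} {x′} → toℕ x ≡ x′ → G x ≡ g (λ i → inWindow k M (toℕ i) x′)
  at x≡x′ = g-cong (λ i → cong (inWindow k M (toℕ i)) x≡x′)
  top : ∀ x → G (x ↑ˡ p ↑ˡ k) ≡ g (λ i → toℕ i ≤ᵇ toℕ x)
  top x = trans (at (trans (toℕ-↑ˡ (x ↑ˡ p) k) (toℕ-↑ˡ x p)))
                (g-cong (λ i → inWindow-top {k} {p} {toℕ i} (toℕ<n x)))
  mid : ∀ v → G ((k ↑ʳ v) ↑ˡ k) ≡ g (λ _ → true)
  mid v = trans (at (trans (toℕ-↑ˡ (k ↑ʳ v) k) (toℕ-↑ʳ k v)))
                (g-cong (λ i → inWindow-mid {k} {p} (<⇒≤ (toℕ<n i)) (<⇒≤ (toℕ<n v))))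
  bot : ∀ u → G (k + p ↑ʳ u) ≡ g (λ i → toℕ u ≤ᵇ toℕ i)
  bot u = trans (at (toℕ-↑ʳ (k + p) u)) (g-cong (λ i → inWindow-bot {k} {p} {toℕ i} (toℕ<n i)))

-- corner rowOK colOK Q x y unfolds to not (Q x y) ∧ not (quadrant rowOK colOK Q x y).
quadrant : ∀ {s t} (rowOK colOK : ℕ → ℕ → Bool) → Matrix s t → Fin s → Fin t → Bool
quadrant rowOK colOK Q x y = hits Q (λ i → rowOK (toℕ i) (toℕ x)) (λ j → colOK (toℕ j) (toℕ y))

quadrant-corner-complement : ∀ {s t} (rowOK colOK : ℕ → ℕ → Bool) (Q : Matrix s t) →
  (∀ n → rowOK n n ≡ true) → (∀ n → colOK n n ≡ true) →
  count2 (quadrant rowOK colOK Q) + count2 (corner rowOK colOK Q) ≡ s * t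
quadrant-corner-complement rowOK colOK Q rowOK-refl colOK-refl =
  count2-complement (quadrant rowOK colOK Q) (corner rowOK colOK Q) λ x y →
    bit-complement (quadrant rowOK colOK Q x y) (Q x y)
      (hits-intro {Q = Q} {λ i → rowOK (toℕ i) (toℕ x)} {λ j → colOK (toℕ j) (toℕ y)}
                  x y (rowOK-refl (toℕ x)) (colOK-refl (toℕ y)))

rowsReached : ∀ {s t} (rowOK : ℕ → ℕ → Bool) → Matrix s t → ℕ
rowsReached {s} rowOK Q = ∑[ x < s ] bit (hits Q (λ i → rowOK (toℕ i) (toℕ x)) (λ _ → true))

colsReached : ∀ {s t} (colOK : ℕ → ℕ → Bool) → Matrix s t → ℕ
colsReached {t = t} colOK Q = ∑[ y < t ] bit (hits Q (λ _ → true) (λ j → colOK (toℕ j) (toℕ y)))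

rowsReached-core : ∀ {s t} {Q : Matrix s t} {s′} → CoreRows Q s′ →
  rowsReached _≤ᵇ_ Q + rowsReached _≥ᵇ_ Q ≡ s + s′
rowsReached-core {s} {Q = Q} {s′}
  (a , b , a+s′+b≡s , _ , zeroAbove , zeroBelow , (i₀ , i₀≡a , j₀ , Qi₀j₀) , (i₁ , 1+i₁≡a+s′ , j₁ , Qi₁j₁)) =
  begin
    rowsReached _≤ᵇ_ Q + rowsReached _≥ᵇ_ Q
      ≡⟨ cong₂ _+_ above below ⟩
    a * 0 + (s′ + b) * 1 + ((a + s′) * 1 + b * 0)
      ≡⟨ regroup a s′ b ⟩
    a + s′ + b + s′
      ≡⟨ cong (_+ s′) a+s′+b≡s ⟩
    s + s′ ∎
  where
  open ≡-Reasoning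
  regroup : ∀ a s′ b → a * 0 + (s′ + b) * 1 + ((a + s′) * 1 + b * 0) ≡ a + s′ + b + s′
  regroup = solve-∀
  above : rowsReached _≤ᵇ_ Q ≡ a * 0 + (s′ + b) * 1
  above = sum-piecewise a (s′ + b) (trans (sym (+-assoc a s′ b)) a+s′+b≡s) _
    (λ x x<a → cong bit (hits-false {Q = Q} {λ i → toℕ i ≤ᵇ toℕ x}
      (λ i j i≤x _ → zeroAbove i (≤-<-trans (≤ᵇ≡true⇒≤ i≤x) x<a) j)))
    (λ x a≤x → cong bit (hits-intro {Q = Q} {λ i → toℕ i ≤ᵇ toℕ x} i₀ j₀
      (≤⇒≤ᵇ≡true (subst (_≤ toℕ x) (sym i₀≡a) a≤x)) refl Qi₀j₀))
  below : rowsReached _≥ᵇ_ Q ≡ (a + s′) * 1 + b * 0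
  below = sum-piecewise (a + s′) b a+s′+b≡s _
    (λ u u<a+s′ → cong bit (hits-intro {Q = Q} {λ i → toℕ u ≤ᵇ toℕ i} i₁ j₁
      (≤⇒≤ᵇ≡true (s≤s⁻¹ (subst (suc (toℕ u) ≤_) (sym 1+i₁≡a+s′) u<a+s′))) refl Qi₁j₁))
    (λ u a+s′≤u → cong bit (hits-false {Q = Q} {λ i → toℕ u ≤ᵇ toℕ i}
      (λ i j u≤i _ → zeroBelow i (≤-trans a+s′≤u (≤ᵇ≡true⇒≤ u≤i)) j)))

colsReached-transpose : ∀ {s t} (colOK : ℕ → ℕ → Bool) (Q : Matrix s t) →
  colsReached colOK Q ≡ rowsReached colOK (transpose Q)
colsReached-transpose {t = t} colOK Q =
  sum-cong-≗ {t} (λ y → cong bit (hits-transpose Q (λ _ → true) (λ j → colOK (toℕ j) (toℕ y))))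

colsReached-core : ∀ {s t} {Q : Matrix s t} {t′} → CoreCols Q t′ →
  colsReached _≤ᵇ_ Q + colsReached _≥ᵇ_ Q ≡ t + t′
colsReached-core {Q = Q} cc =
  trans (cong₂ _+_ (colsReached-transpose _≤ᵇ_ Q) (colsReached-transpose _≥ᵇ_ Q))
        (rowsReached-core {Q = transpose Q} cc)

ones-forced-blocks : ∀ {s t} (Q : Matrix s t) p q →
  ones (forced Q (s + p + s) (t + q + t))
    ≡ (count2 (quadrant _≤ᵇ_ _≤ᵇ_ Q) + q * rowsReached _≤ᵇ_ Q + count2 (quadrant _≤ᵇ_ _≥ᵇ_ Q))
      + p * (colsReached _≤ᵇ_ Q + q * bit (hits Q (λ _ → true) (λ _ → true)) + colsReached _≥ᵇ_ Q)
      + (count2 (quadrant _≥ᵇ_ _≤ᵇ_ Q) + q * rowsReached _≥ᵇ_ Q + count2 (quadrant _≥ᵇ_ _≥ᵇ_ Q))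
ones-forced-blocks {s} {t} Q p q = begin
  ones (forced Q M N)
    ≡⟨ count2≡∑∑ (forced Q M N) ⟩
  ∑[ x < M ] G (window s M x)
    ≡⟨ sum-windows s p G (λ R≗R′ → sum-cong-≗ {N} (λ y → cong bit (hits-cong {Q = Q} R≗R′ λ _ → refl))) ⟩
  ∑[ x < s ] G (λ i → toℕ i ≤ᵇ toℕ x) + p * G (λ _ → true) + ∑[ u < s ] G (λ i → toℕ u ≤ᵇ toℕ i)
    ≡⟨ cong₂ _+_ (cong₂ _+_ (rowBand _≤ᵇ_) (cong (p *_) (columns (λ _ → true)))) (rowBand _≥ᵇ_) ⟩
  _ ∎
  where
  open ≡-Reasoning
  M N : ℕ
  M = s + p + s
  N = t + q + t
  G : (Fin s → Bool) → ℕ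
  G R = ∑[ y < N ] bit (hits Q R (window t N y))
  columns : ∀ R → G R ≡ ∑[ y < t ] bit (hits Q R (λ j → toℕ j ≤ᵇ toℕ y)) + q * bit (hits Q R (λ _ → true))
                         + ∑[ w < t ] bit (hits Q R (λ j → toℕ w ≤ᵇ toℕ j))
  columns R = sum-windows t q (λ C → bit (hits Q R C))
                          (λ C≗C′ → cong bit (hits-cong {Q = Q} {R} {R} (λ _ → refl) C≗C′))
  rowBand : ∀ rowOK → ∑[ x < s ] G (λ i → rowOK (toℕ i) (toℕ x))
    ≡ count2 (quadrant rowOK _≤ᵇ_ Q) + q * rowsReached rowOK Q + count2 (quadrant rowOK _≥ᵇ_ Q)
  rowBand rowOK = begin
    ∑[ x < s ] G (λ i → rowOK (toℕ i) (toℕ x))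
      ≡⟨ sum-cong-≗ {s} (λ x → columns (λ i → rowOK (toℕ i) (toℕ x))) ⟩
    _ ≡⟨ sum-+-* q (λ x → ∑[ y < t ] bit (quadrant rowOK _≤ᵇ_ Q x y))
                   (λ x → bit (hits Q (λ i → rowOK (toℕ i) (toℕ x)) (λ _ → true)))
                   (λ x → ∑[ y < t ] bit (quadrant rowOK _≥ᵇ_ Q x y)) ⟩
    _ ≡⟨ cong₂ _+_ (cong (_+ q * rowsReached rowOK Q) (count2≡∑∑ (quadrant rowOK _≤ᵇ_ Q)))
                   (count2≡∑∑ (quadrant rowOK _≥ᵇ_ Q)) ⟨
    count2 (quadrant rowOK _≤ᵇ_ Q) + q * rowsReached rowOK Q + count2 (quadrant rowOK _≥ᵇ_ Q) ∎

blocks-arithmetic : ∀ {TL TR BL BR nw ne sw se PT PB PL PR c s t s′ t′ : ℕ} p q →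
  TL + nw ≡ s * t → TR + ne ≡ s * t → BL + sw ≡ s * t → BR + se ≡ s * t →
  PT + PB ≡ s + s′ → PL + PR ≡ t + t′ → c ≡ 1 →
  (TL + q * PT + TR) + p * (PL + q * c + PR) + (BL + q * PB + BR) + nw + sw + ne + se
    ≡ (s + s) * (t + t) + q * (s + s′) + p * (t + t′) + p * q
blocks-arithmetic {TL} {TR} {BL} {BR} {nw} {ne} {sw} {se} {PT} {PB} {PL} {PR} {c} {s} {t} {s′} {t′} p q
  TL+nw TR+ne BL+sw BR+se PT+PB PL+PR c≡1 = begin
  (TL + q * PT + TR) + p * (PL + q * c + PR) + (BL + q * PB + BR) + nw + sw + ne + se
    ≡⟨ regroup TL TR BL BR nw ne sw se PT PB PL PR c p q ⟩
  (TL + nw) + (TR + ne) + (BL + sw) + (BR + se) + q * (PT + PB) + p * (PL + PR + q * c)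
    ≡⟨ cong₂ _+_ (cong₂ _+_ (cong₂ _+_ (cong₂ _+_ (cong₂ _+_ TL+nw TR+ne) BL+sw) BR+se) (cong (q *_) PT+PB))
                 (cong (p *_) (cong₂ _+_ PL+PR (cong (q *_) c≡1))) ⟩
  s * t + s * t + s * t + s * t + q * (s + s′) + p * (t + t′ + q * 1)
    ≡⟨ tidy s t s′ t′ p q ⟩
  (s + s) * (t + t) + q * (s + s′) + p * (t + t′) + p * q ∎
  where
  open ≡-Reasoning
  regroup : ∀ TL TR BL BR nw ne sw se PT PB PL PR c p q →
    (TL + q * PT + TR) + p * (PL + q * c + PR) + (BL + q * PB + BR) + nw + sw + ne + se
      ≡ (TL + nw) + (TR + ne) + (BL + sw) + (BR + se) + q * (PT + PB) + p * (PL + PR + q * c)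
  regroup = solve-∀
  tidy : ∀ s t s′ t′ p q → s * t + s * t + s * t + s * t + q * (s + s′) + p * (t + t′ + q * 1)
    ≡ (s + s) * (t + t) + q * (s + s′) + p * (t + t′) + p * q
  tidy = solve-∀

ones-forced+corners : ∀ {s t} (Q : Matrix s t) → NotAllZero Q → ∀ {s′ t′} → CoreDims Q s′ t′ → ∀ p q →
  ones (forced Q (s + p + s) (t + q + t)) + count2 (NW Q) + count2 (SW Q) + count2 (NE Q) + count2 (SE Q)
    ≡ (s + s) * (t + t) + q * (s + s′) + p * (t + t′) + p * q
ones-forced+corners Q (i , j , Qij) {s′} {t′} (rows , cols) p q = trans
  (cong (λ z → z + count2 (NW Q) + count2 (SW Q) + count2 (NE Q) + count2 (SE Q)) (ones-forced-blocks Q p q))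
  (blocks-arithmetic {quadrantCount _≤ᵇ_ _≤ᵇ_} {quadrantCount _≤ᵇ_ _≥ᵇ_}
                    {quadrantCount _≥ᵇ_ _≤ᵇ_} {quadrantCount _≥ᵇ_ _≥ᵇ_}
                    {count2 (NW Q)} {count2 (NE Q)} {count2 (SW Q)} {count2 (SE Q)}
                    {rowsReached _≤ᵇ_ Q} {rowsReached _≥ᵇ_ Q} {colsReached _≤ᵇ_ Q} {colsReached _≥ᵇ_ Q}
                    {s′ = s′} {t′} p q
    (quadrant-corner-complement _≤ᵇ_ _≤ᵇ_ Q ≤ᵇ-refl ≤ᵇ-refl)
    (quadrant-corner-complement _≤ᵇ_ _≥ᵇ_ Q ≤ᵇ-refl ≤ᵇ-refl)
    (quadrant-corner-complement _≥ᵇ_ _≤ᵇ_ Q ≤ᵇ-refl ≤ᵇ-refl)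
    (quadrant-corner-complement _≥ᵇ_ _≥ᵇ_ Q ≤ᵇ-refl ≤ᵇ-refl)
    (rowsReached-core rows)
    (colsReached-core cols)
    (cong bit (hits-intro {Q = Q} {λ _ → true} {λ _ → true} i j refl refl Qij)))
  where
  quadrantCount : (ℕ → ℕ → Bool) → (ℕ → ℕ → Bool) → ℕ
  quadrantCount rowOK colOK = count2 (quadrant rowOK colOK Q)
  ≤ᵇ-refl : ∀ n → (n ≤ᵇ n) ≡ true
  ≤ᵇ-refl n = ≤⇒≤ᵇ≡true (≤-refl {n})

open import Data.Integer using (ℤ; +_; _-_) renaming (_+_ to _+ℤ_; _*_ to _*ℤ_)
open import Data.Integer.Properties using (pos-*)
import Data.Integer.Tactic.RingSolver as ℤ-Solver

ℤ-rearrange : ∀ (K NW SW NE SE S T S′ T′ P Q : ℤ) →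
  K +ℤ NW +ℤ SW +ℤ NE +ℤ SE ≡ (S +ℤ S) *ℤ (T +ℤ T) +ℤ Q *ℤ (S +ℤ S′) +ℤ P *ℤ (T +ℤ T′) +ℤ P *ℤ Q →
  K ≡ (S +ℤ P +ℤ S) *ℤ (T +ℤ Q +ℤ T)
      - ((S +ℤ P +ℤ S) - (S +ℤ S)) *ℤ (T - T′)
      - ((T +ℤ Q +ℤ T) - (T +ℤ T)) *ℤ (S - S′)
      - NW - SW - NE - SE
ℤ-rearrange K NW SW NE SE S T S′ T′ P Q total = begin
  K
    ≡⟨ isolate K NW SW NE SE ⟩
  K +ℤ NW +ℤ SW +ℤ NE +ℤ SE - NW - SW - NE - SE
    ≡⟨ cong (λ z → z - NW - SW - NE - SE) total ⟩
  (S +ℤ S) *ℤ (T +ℤ T) +ℤ Q *ℤ (S +ℤ S′) +ℤ P *ℤ (T +ℤ T′) +ℤ P *ℤ Q - NW - SW - NE - SE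
    ≡⟨ expand S T S′ T′ P Q NW SW NE SE ⟩
  _ ∎
  where
  open ≡-Reasoning
  isolate : ∀ K NW SW NE SE → K ≡ K +ℤ NW +ℤ SW +ℤ NE +ℤ SE - NW - SW - NE - SE
  isolate = ℤ-Solver.solve-∀
  expand : ∀ S T S′ T′ P Q NW SW NE SE →
    (S +ℤ S) *ℤ (T +ℤ T) +ℤ Q *ℤ (S +ℤ S′) +ℤ P *ℤ (T +ℤ T′) +ℤ P *ℤ Q - NW - SW - NE - SE
      ≡ (S +ℤ P +ℤ S) *ℤ (T +ℤ Q +ℤ T)
        - ((S +ℤ P +ℤ S) - (S +ℤ S)) *ℤ (T - T′)
        - ((T +ℤ Q +ℤ T) - (T +ℤ T)) *ℤ (S - S′)
        - NW - SW - NE - SE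
  expand = ℤ-Solver.solve-∀

count-identity-ℤ : ∀ {k nw sw ne se s t s′ t′ p q : ℕ} →
  k + nw + sw + ne + se ≡ (s + s) * (t + t) + q * (s + s′) + p * (t + t′) + p * q →
  + k ≡ + ((s + p + s) * (t + q + t))
        - ((+ (s + p + s) - + (2 * s)) *ℤ (+ t - + t′))
        - ((+ (t + q + t) - + (2 * t)) *ℤ (+ s - + s′))
        - + nw - + sw - + ne - + se
count-identity-ℤ {k} {nw} {sw} {ne} {se} {s} {t} {s′} {t′} {p} {q} total
  -- 2 * s computes to s + (s + 0); and since + a +ℤ + b computes to + (a + b), only products need pos-*.
  rewrite pos-* (s + p + s) (t + q + t) | +-identityʳ s | +-identityʳ t =
  ℤ-rearrange (+ k) (+ nw) (+ sw) (+ ne) (+ se) (+ s) (+ t) (+ s′) (+ t′) (+ p) (+ q) pos-total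
  where
  pos-total : + k +ℤ + nw +ℤ + sw +ℤ + ne +ℤ + se
    ≡ (+ s +ℤ + s) *ℤ (+ t +ℤ + t) +ℤ + q *ℤ (+ s +ℤ + s′) +ℤ + p *ℤ (+ t +ℤ + t′) +ℤ + p *ℤ + q
  pos-total
    rewrite sym (pos-* (s + s) (t + t)) | sym (pos-* q (s + s′)) | sym (pos-* p (t + t′)) | sym (pos-* p q)
    = cong +_ total

2*m≤n⇒∃[o]m+o+m≡n : ∀ {m n} → 2 * m ≤ n → ∃[ o ] m + o + m ≡ n
2*m≤n⇒∃[o]m+o+m≡n {m} 2m≤n =
  let o , 2m+o≡n = m≤n⇒∃[o]m+o≡n 2m≤n
  in o , trans (reorder m o) 2m+o≡n
  where
  reorder : ∀ m o → m + o + m ≡ 2 * m + o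
  reorder = solve-∀

corollary2 : ∀ {s t : ℕ} (Q : Matrix s t) → NotAllZero Q →
    ∀ (s' t' : ℕ) → CoreDims Q s' t' →
    ∀ (m n : ℕ) → 2 * s ≤ m → 2 * t ≤ n →
    Σ ℕ λ k → IsMinForcing m n Q k ×
      (+ k ≡ + (m * n)
             - ((+ m - + (2 * s)) *ℤ (+ t - + t'))
             - ((+ n - + (2 * t)) *ℤ (+ s - + s'))
             - + count2 (NW Q) - + count2 (SW Q)
             - + count2 (NE Q) - + count2 (SE Q))
corollary2 {s} {t} Q nonzero s' t' core m n 2s≤m 2t≤n
  with p , refl ← 2*m≤n⇒∃[o]m+o+m≡n {s} 2s≤m | q , refl ← 2*m≤n⇒∃[o]m+o+m≡n {t} 2t≤n
  = ones (forced Q m n) , forced-isMinForcing Q m n ,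
    count-identity-ℤ {s = s} {t} {s'} {t'} {p} {q} (ones-forced+corners Q nonzero core p q)
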